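{- Let $n\ge4$ and let $CSL$ be the inductive strategy of length $n$ with $CSL[n]=[n,1,2,\dots,n-1]$. Then the number of permutations $\pi\in S_n$ such that the game with strategy $CSL$ and secret $\pi$ ends after exactly three guesses and $\rho_{CSL}(\pi)=2$ equals $L_n-n-1$, where $L_n$ is the $n$-th Lucas number.
   Context: Permutation wordle on $[n]=\{1,\dots,n\}$: a secret permutation $\pi\in S_n$ (one-line notation) is fixed. The first guess is $\gamma_1=[1,2,\dots,n]$. After guess $\gamma_r$ the guesser learns $\mathcal{J}_r=\{i:\gamma_r(i)=\pi(i)\}$; $\mathcal{I}_r=[n]\setminus\mathcal{J}_r$. The game ends at the first $r$ with $\mathcal{J}_r=[n]$. A strategy of length $n$ is a sequence $S=(S[1],\dots,S[n])$ with $S[k]$ a permutation of $[k]$; if $\mathcal{I}_r=\{i_1<\dots<i_k\}\neq\emptyset$ and $\sigma=S[k]$, then $\gamma_{r+1}(i)=\gamma_r(i)$ for $i\in\mathcal{J}_r$ and $\gamma_{r+1}(i_{\sigma(j)})=\gamma_r(i_j)$ for $j=1,\dots,k$. The cyclic shift strategy $CS$ has $CS[k]=[2,3,\dots,k,1]$; the strategy $CSL$ of length $n$ has $CSL[k]=CS[k]$ for $k\le n-1$ and $CSL[n]=[n,1,2,\dots,n-1]$. For a secret $\pi$, $\rho_S(\pi)=\min\{i:\mathcal{J}_i\neq\emptyset\}$. Lucas numbers: $L_0=2$, $L_1=1$, $L_m=L_{m-1}+L_{m-2}$. -}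

module Defs where

open import Data.Nat using (ℕ; zero; suc; _+_; _≡ᵇ_)
open import Data.Bool using (Bool; true; false; not; _∧_; if_then_else_)
open import Data.Fin using (Fin; zero; suc; fromℕ; inject₁; _≟_)
open import Data.Vec as V using (Vec; []; _∷_; _∷ʳ_; allFin; lookup; tabulate)
open import Data.List as L using (List; []; _∷_; length; filterᵇ; concatMap; null)
open import Data.Bool.ListAction using (and)
open import Data.Product using (_×_; _,_; proj₁; proj₂)
open import Relation.Nullary.Decidable using (⌊_⌋)

-- Conventions: positions and values are 0-based, i.e. [n] = {1..n} is
-- represented by Fin n = {0..n-1} (element i+1 of [n] is the Fin element i).
-- A permutation in one-line notation is a Vec (Fin n) n.

lucas : ℕ → ℕ
lucas zero = 2
lucas (suc zero) = 1
lucas (suc (suc m)) = lucas (suc m) + lucas m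

_==_ : ∀ {n} → Fin n → Fin n → Bool
i == j = ⌊ i ≟ j ⌋

allVecs : (n m : ℕ) → List (Vec (Fin n) m)
allVecs n zero = [] ∷ []
allVecs n (suc m) = concatMap (λ i → L.map (i ∷_) (allVecs n m)) (L.allFin n)

distinct : ∀ {n m} → Vec (Fin n) m → Bool
distinct [] = true
distinct (x ∷ xs) = and (L.map (λ y → not (x == y)) (V.toList xs)) ∧ distinct xs

perms : (n : ℕ) → List (Vec (Fin n) n)
perms n = filterᵇ distinct (allVecs n n)

-- A strategy: S k is a permutation of [k] in one-line notation (0-based),
-- used for 1 ≤ k ≤ n in a game of length n.
Strategy : Set
Strategy = (k : ℕ) → Vec (Fin k) k

CS : (k : ℕ) → Vec (Fin k) k
CS zero = []
CS (suc m) = V.map suc (allFin m) ∷ʳ zero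

CSlast : (k : ℕ) → Vec (Fin k) k
CSlast zero = []
CSlast (suc m) = fromℕ m ∷ V.map inject₁ (allFin m)

CSL : (n : ℕ) → Strategy
CSL n k = if k ≡ᵇ n then CSlast k else CS k

Guess : ℕ → Set
Guess n = Fin n → Fin n

Jset : ∀ {n} → Vec (Fin n) n → Guess n → List (Fin n)
Jset π γ = filterᵇ (λ i → γ i == lookup π i) (L.allFin n)
  where n = _

Iset : ∀ {n} → Vec (Fin n) n → Guess n → List (Fin n)
Iset {n} π γ = filterᵇ (λ i → not (γ i == lookup π i)) (L.allFin n)

assoc : ∀ {n} → List (Fin n × Fin n) → Fin n → Fin n → Fin n
assoc [] i d = d
assoc ((p , v) ∷ ps) i d = if p == i then v else assoc ps i d

-- One move of the strategy: with I = {i_1 < ... < i_k}, σ = S[k],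
-- γ'(i) = γ(i) for i ∈ J and γ'(i_{σ(j)}) = γ(i_j).
step : ∀ {n} → Strategy → Vec (Fin n) n → Guess n → Guess n
step {n} S π γ i = assoc moves i (γ i)
  where
  Is = Iset π γ
  k = length Is
  Iv : Vec (Fin n) k
  Iv = V.fromList Is
  σ : Vec (Fin k) k
  σ = S k
  moves : List (Fin n × Fin n)
  moves = L.map (λ j → lookup Iv (lookup σ j) , γ (lookup Iv j)) (L.allFin k)

guess : ∀ {n} → ℕ → Strategy → Vec (Fin n) n → Guess n
guess zero S π = λ i → i      -- unused (no guess number 0)
guess (suc zero) S π = λ i → i
guess (suc (suc r)) S π = step S π (guess (suc r) S π)

J : ∀ {n} → ℕ → Strategy → Vec (Fin n) n → List (Fin n)
J r S π = Jset π (guess r S π)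

Jfull : ∀ {n} → ℕ → Strategy → Vec (Fin n) n → Bool
Jfull {n} r S π = length (J r S π) ≡ᵇ n

endsAt3 : ∀ {n} → Strategy → Vec (Fin n) n → Bool
endsAt3 S π = not (Jfull 1 S π) ∧ not (Jfull 2 S π) ∧ Jfull 3 S π

rhoIs2 : ∀ {n} → Strategy → Vec (Fin n) n → Bool
rhoIs2 S π = null (J 1 S π) ∧ not (null (J 2 S π))

countCSL : ℕ → ℕ
countCSL n = length (filterᵇ (λ π → endsAt3 (CSL n) π ∧ rhoIs2 (CSL n) π) (perms n))

-- If ρ(π) = 2 then π is a derangement, so in the first round every value moves along
-- CSL[n] = CS[n]⁻¹ and the second guess is the cyclic shift i ↦ i + 1.  The set
-- B = {i : π(i) ≠ i + 1} of its mistakes then determines π: the third guess agrees with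
-- the shift off B and rotates it along the increasing enumeration of B by CS[|B|]
-- (|B| < n, because some position is right).  This guess is π exactly when B is an
-- independent set of the n-cycle with |B| ≥ 2: cyclically adjacent elements of B are
-- consecutive in the enumeration, which would give π a fixed point, while |B| = 0 makes
-- the second guess correct and |B| = 1 makes CS[1] the identity.  The independent sets
-- of the n-cycle are counted by L_n, and n + 1 of them have at most one element.
module Submission where

open import Algebra.Properties.CommutativeSemigroup using (interchange)
open import Data.Bool using (Bool; true; false; not; _∧_; T)
open import Data.Bool.Properties using (T-∧; T-≡; T-not-≡; ∧-zeroʳ; ∧-identityʳ)
open import Data.Fin as F using (Fin; zero; suc; toℕ; fromℕ; inject₁)
import Data.Fin.Properties as F
open import Data.Fin.Relation.Unary.Top using (view; ‵fromℕ; ‵inject₁)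
open import Data.List as L using (List; []; _∷_; _++_; length; map; concatMap; filterᵇ; allFin)
open import Data.List.Membership.Propositional using (_∈_)
open import Data.List.Membership.Propositional.Properties
  using (∈-map⁺; ∈-map⁻; ∈-concatMap⁺; ∈-lookup; ∈-allFin; ∈-filter⁺; ∈-filter⁻)
open import Data.List.Membership.Propositional.Properties.WithK using (unique∧set⇒bag)
open import Data.List.Properties
  using ( length-map; length-++; length-tabulate; map-cong; map-tabulate; lookup-tabulate; ++-identityʳ
        ; filter-++; filter-all; filter-none; filter-notAll; filter-complete; filter-≐ )
open import Data.List.Relation.Binary.BagAndSetEquality using (_∼[_]_; set; ∼bag⇒↭)
open import Data.List.Relation.Binary.Disjoint.Propositional using (Disjoint)
open import Data.List.Relation.Binary.Permutation.Propositional.Properties using (↭-length)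
import Data.List.Relation.Unary.All as All
import Data.List.Relation.Unary.All.Properties as All
open import Data.List.Relation.Unary.AllPairs as AllPairs using (AllPairs; _∷_)
import Data.List.Relation.Unary.AllPairs.Properties as AllPairs
open import Data.List.Relation.Unary.Any as Any using (here; there)
open import Data.List.Relation.Unary.Any.Properties using (lookup-index)
open import Data.List.Relation.Unary.Unique.Propositional using (Unique)
import Data.List.Relation.Unary.Unique.Propositional.Properties as Unique
open import Data.Nat using (ℕ; zero; suc; _+_; _∸_; _≤_; _<_; _<ᵇ_; _≡ᵇ_; z≤n; s≤s; z<s; s≤s⁻¹)
open import Data.Nat.Properties
  using ( +-comm; +-suc; +-identityʳ; m+n∸m≡n; +-commutativeSemigroup; suc-injective; 1+n≢n
        ; ≤-refl; ≤-reflexive; ≤-antisym; <-irrefl; <-asym; <-trans; <-≤-trans; <⇒≢; <⇒≱; ≮⇒≥; n≮0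
        ; ≡ᵇ⇒≡; ≡⇒≡ᵇ )
open import Data.Product using (_×_; _,_; proj₁; proj₂; ∃; map₂)
open import Data.Vec as V using (Vec; []; _∷_; _∷ʳ_; lookup; tabulate)
open import Data.Vec.Properties
  using (∷-injectiveˡ; ∷-injectiveʳ; lookup-map; lookup-allFin; lookup∘tabulate; tabulate∘lookup; tabulate-cong)
import Data.Vec.Relation.Unary.All.Properties as VecAll
open import Function.Base using (_∘_; id)
open import Function.Bundles using (Equivalence; _⇔_; mk⇔)
open import Function.Definitions using (Injective)
open import Relation.Binary.Core using (_Preserves_⟶_)
open import Relation.Binary.Definitions using (tri<; tri≈; tri>)
open import Relation.Binary.PropositionalEquality
  using (_≡_; _≢_; refl; sym; trans; cong; cong₂; subst; subst₂; module ≡-Reasoning)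
open import Relation.Nullary using (¬_; contradiction; yes; no)
open import Relation.Nullary.Decidable
  using (T?; ¬?; decidable-stable; toWitness; fromWitness; toWitnessFalse; fromWitnessFalse)

open import Defs
open Equivalence using (to; from)

vectors : {A : Set} → List A → (m : ℕ) → List (Vec A m)
vectors xs zero    = [] ∷ []
vectors xs (suc m) = concatMap (λ x → map (x ∷_) (vectors xs m)) xs

allVecs≡vectors : ∀ n m → allVecs n m ≡ vectors (allFin n) m
allVecs≡vectors n zero    = refl
allVecs≡vectors n (suc m) = cong (λ vs → concatMap (λ i → map (i ∷_) vs) (allFin n)) (allVecs≡vectors n m)

∈-vectors : {A : Set} {xs : List A} → (∀ x → x ∈ xs) → ∀ {m} (v : Vec A m) → v ∈ vectors xs m
∈-vectors complete []      = here refl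
∈-vectors complete (x ∷ v) = ∈-concatMap⁺ (λ y → map (y ∷_) (vectors _ _))
  (Any.map (λ { refl → ∈-map⁺ (x ∷_) (∈-vectors complete v) }) (complete x))

vectors-unique : {A : Set} {xs : List A} → Unique xs → ∀ m → Unique (vectors xs m)
vectors-unique u zero    = All.[] ∷ AllPairs.[]
vectors-unique u (suc m) =
  Unique.concat⁺ (All.map⁺ (All.universal (λ _ → Unique.map⁺ ∷-injectiveʳ (vectors-unique u m)) _))
                 (AllPairs.map⁺ (AllPairs.map disjoint u))
  where
  disjoint : ∀ {x y} → x ≢ y → Disjoint (map (x ∷_) (vectors _ m)) (map (y ∷_) (vectors _ m))
  disjoint x≢y (v∈ , v∈′) with ∈-map⁻ (_ ∷_) v∈ | ∈-map⁻ (_ ∷_) v∈′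
  ... | _ , _ , refl | _ , _ , eq = x≢y (∷-injectiveˡ eq)

bools : List Bool
bools = false ∷ true ∷ []

∈-bools : ∀ b → b ∈ bools
∈-bools false = here refl
∈-bools true  = there (here refl)

bools-unique : Unique bools
bools-unique = ((λ ()) All.∷ All.[]) ∷ All.[] ∷ AllPairs.[]

perms-unique : ∀ n → Unique (perms n)
perms-unique n = Unique.filter⁺ (T? ∘ distinct)
  (subst Unique (sym (allVecs≡vectors n n)) (vectors-unique (Unique.allFin⁺ n) n))

distinct-injective : ∀ {n m} (u : Vec (Fin n) m) → Injective _≡_ _≡_ (lookup u) → T (distinct u)
distinct-injective []       _   = _
distinct-injective (x ∷ xs) inj = from T-∧
  ( All.all⁻ (λ y → not (x == y))
      (VecAll.toList⁺ (VecAll.lookup⁻ {xs = xs} λ j → fromWitnessFalse (F.0≢1+n ∘ inj {zero} {suc j})))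
  , distinct-injective xs (F.suc-injective ∘ inj) )

∈-perms : ∀ {n} {π : Vec (Fin n) n} → Injective _≡_ _≡_ (lookup π) → π ∈ perms n
∈-perms {n} {π} inj = ∈-filter⁺ (T? ∘ distinct)
  (subst (π ∈_) (sym (allVecs≡vectors n n)) (∈-vectors ∈-allFin π)) (distinct-injective π inj)

length-filterᵇ-map : ∀ {A B : Set} (p : B → Bool) (f : A → B) xs →
                     length (filterᵇ p (map f xs)) ≡ length (filterᵇ (p ∘ f) xs)
length-filterᵇ-map p f []       = refl
length-filterᵇ-map p f (x ∷ xs) with p (f x)
... | true  = cong suc (length-filterᵇ-map p f xs)
... | false = length-filterᵇ-map p f xs

length-filterᵇ-false : ∀ {A : Set} (xs : List A) → length (filterᵇ (λ _ → false) xs) ≡ 0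
length-filterᵇ-false xs = cong length (filter-none (T? ∘ λ _ → false) (All.universal (λ _ ()) xs))

filterᵇ-≗ : ∀ {A : Set} {p q : A → Bool} → (∀ x → p x ≡ q x) → ∀ xs → filterᵇ p xs ≡ filterᵇ q xs
filterᵇ-≗ p≗q = filter-≐ (T? ∘ _) (T? ∘ _) ((λ {x} → subst T (p≗q x)) , (λ {x} → subst T (sym (p≗q x))))

length-filterᵇ-split : ∀ {A : Set} (p q : A → Bool) xs →
  length (filterᵇ (λ x → p x ∧ q x) xs) + length (filterᵇ (λ x → p x ∧ not (q x)) xs) ≡ length (filterᵇ p xs)
length-filterᵇ-split p q []       = refl
length-filterᵇ-split p q (x ∷ xs) with p x | q x
... | false | _     = length-filterᵇ-split p q xs
... | true  | true  = cong suc (length-filterᵇ-split p q xs)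
... | true  | false = trans (+-suc _ _) (cong suc (length-filterᵇ-split p q xs))

length-filterᵇ-boolVectors : ∀ m (p : Vec Bool (suc m) → Bool) →
  length (filterᵇ p (vectors bools (suc m)))
    ≡ length (filterᵇ (p ∘ (false ∷_)) (vectors bools m)) + length (filterᵇ (p ∘ (true ∷_)) (vectors bools m))
length-filterᵇ-boolVectors m p = begin
  length (filterᵇ p (map (false ∷_) vs ++ map (true ∷_) vs ++ []))
    ≡⟨ cong length (filter-++ (T? ∘ p) (map (false ∷_) vs) _) ⟩
  length (filterᵇ p (map (false ∷_) vs) ++ filterᵇ p (map (true ∷_) vs ++ []))
    ≡⟨ length-++ (filterᵇ p (map (false ∷_) vs)) ⟩
  length (filterᵇ p (map (false ∷_) vs)) + length (filterᵇ p (map (true ∷_) vs ++ []))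
    ≡⟨ cong (length (filterᵇ p (map (false ∷_) vs)) +_)
            (cong (length ∘ filterᵇ p) (++-identityʳ (map (true ∷_) vs))) ⟩
  length (filterᵇ p (map (false ∷_) vs)) + length (filterᵇ p (map (true ∷_) vs))
    ≡⟨ cong₂ _+_ (length-filterᵇ-map p (false ∷_) vs) (length-filterᵇ-map p (true ∷_) vs) ⟩
  length (filterᵇ (p ∘ (false ∷_)) vs) + length (filterᵇ (p ∘ (true ∷_)) vs) ∎
  where
  open ≡-Reasoning
  vs : List (Vec Bool m)
  vs = vectors bools m

length-≡-bijection : ∀ {A B : Set} {xs : List A} {ys : List B} (f : A → B) (g : B → A) →
  Unique xs → Unique ys →
  (∀ {x} → x ∈ xs → f x ∈ ys × g (f x) ≡ x) →
  (∀ {y} → y ∈ ys → g y ∈ xs × f (g y) ≡ y) →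
  length xs ≡ length ys
length-≡-bijection {xs = xs} {ys} f g xs-unique ys-unique xs→ys ys→xs =
  trans (sym (length-map f xs)) (↭-length (∼bag⇒↭ (unique∧set⇒bag fxs-unique ys-unique fxs∼ys)))
  where
  fxs-unique : Unique (map f xs)
  fxs-unique = unique-map xs-unique λ x∈ y∈ fx≡fy →
    trans (sym (proj₂ (xs→ys x∈))) (trans (cong g fx≡fy) (proj₂ (xs→ys y∈)))
    where
    unique-map : ∀ {zs} → Unique zs → (∀ {x y} → x ∈ zs → y ∈ zs → f x ≡ f y → x ≡ y) →
                 Unique (map f zs)
    unique-map AllPairs.[] _   = AllPairs.[]
    unique-map (x∉ ∷ u)    inj =
      All.map⁺ (All.tabulate (λ y∈ fx≡fy → All.lookup x∉ y∈ (inj (here refl) (there y∈) fx≡fy)))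
      ∷ unique-map u (λ x∈ y∈ → inj (there x∈) (there y∈))
  fxs∼ys : map f xs ∼[ set ] ys
  fxs∼ys = mk⇔
    (λ z∈ → let x , x∈ , z≡fx = ∈-map⁻ f z∈ in subst (_∈ ys) (sym z≡fx) (proj₁ (xs→ys x∈)))
    (λ z∈ → subst (_∈ map f xs) (proj₂ (ys→xs z∈)) (∈-map⁺ f (proj₁ (ys→xs z∈))))

length-filterᵇ-bijection : ∀ {A B : Set} {xs : List A} {ys : List B} {p : A → Bool} {q : B → Bool}
  (f : A → B) (g : B → A) → Unique xs → Unique ys →
  (∀ {x} → x ∈ xs → T (p x) → f x ∈ ys × T (q (f x)) × g (f x) ≡ x) →
  (∀ {y} → y ∈ ys → T (q y) → g y ∈ xs × T (p (g y)) × f (g y) ≡ y) →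
  length (filterᵇ p xs) ≡ length (filterᵇ q ys)
length-filterᵇ-bijection {p = p} {q} f g xs-unique ys-unique xs→ys ys→xs =
  length-≡-bijection f g (Unique.filter⁺ (T? ∘ p) xs-unique) (Unique.filter⁺ (T? ∘ q) ys-unique)
    (λ x∈ → let x∈xs , px = ∈-filter⁻ (T? ∘ p) x∈; fx∈ , qfx , gfx≡x = xs→ys x∈xs px
            in ∈-filter⁺ (T? ∘ q) fx∈ qfx , gfx≡x)
    (λ y∈ → let y∈ys , qy = ∈-filter⁻ (T? ∘ q) y∈; gy∈ , pgy , fgy≡y = ys→xs y∈ys qy
            in ∈-filter⁺ (T? ∘ p) gy∈ pgy , fgy≡y)

-- Independent sets of a cycle and Lucas numbers

-- noAdjacentTrues p w e: no two consecutive entries of p ∷ w ∷ʳ e are both true.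
noAdjacentTrues : ∀ {m} → Bool → Vec Bool m → Bool → Bool
noAdjacentTrues p []      e = not (p ∧ e)
noAdjacentTrues p (x ∷ w) e = not (p ∧ x) ∧ noAdjacentTrues x w e

cyclicallyIndependent : ∀ {m} → Vec Bool m → Bool
cyclicallyIndependent []      = true
cyclicallyIndependent (x ∷ w) = noAdjacentTrues x w x

pathCount : Bool → Bool → ℕ → ℕ
pathCount p e m = length (filterᵇ (λ w → noAdjacentTrues p w e) (vectors bools m))

fib : ℕ → ℕ
fib zero          = 0
fib (suc zero)    = 1
fib (suc (suc m)) = fib (suc m) + fib m

pathCount-false-suc : ∀ e m → pathCount false e (suc m) ≡ pathCount false e m + pathCount true e m
pathCount-false-suc e m = length-filterᵇ-boolVectors m (λ w → noAdjacentTrues false w e)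

pathCount-true-suc : ∀ e m → pathCount true e (suc m) ≡ pathCount false e m
pathCount-true-suc e m = begin
  pathCount true e (suc m)
    ≡⟨ length-filterᵇ-boolVectors m (λ w → noAdjacentTrues true w e) ⟩
  pathCount false e m + length (filterᵇ (λ _ → false) (vectors bools m))
    ≡⟨ cong (pathCount false e m +_) (length-filterᵇ-false (vectors bools m)) ⟩
  pathCount false e m + 0
    ≡⟨ +-identityʳ _ ⟩
  pathCount false e m ∎
  where open ≡-Reasoning

pathCount-ff : ∀ m → pathCount false false m ≡ fib (suc (suc m))
pathCount-ft : ∀ m → pathCount false true  m ≡ fib (suc m)
pathCount-tf : ∀ m → pathCount true  false m ≡ fib (suc m)
pathCount-tt : ∀ m → pathCount true  true  m ≡ fib m
pathCount-ff zero    = refl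
pathCount-ff (suc m) = trans (pathCount-false-suc false m) (cong₂ _+_ (pathCount-ff m) (pathCount-tf m))
pathCount-ft zero    = refl
pathCount-ft (suc m) = trans (pathCount-false-suc true m) (cong₂ _+_ (pathCount-ft m) (pathCount-tt m))
pathCount-tf zero    = refl
pathCount-tf (suc m) = trans (pathCount-true-suc false m) (pathCount-ff m)
pathCount-tt zero    = refl
pathCount-tt (suc m) = trans (pathCount-true-suc true m) (pathCount-ft m)

lucas≡fib+fib : ∀ m → lucas (suc m) ≡ fib (suc (suc m)) + fib m
lucas≡fib+fib zero          = refl
lucas≡fib+fib (suc zero)    = refl
lucas≡fib+fib (suc (suc m)) rewrite lucas≡fib+fib (suc m) | lucas≡fib+fib m =
  interchange +-commutativeSemigroup (fib (3 + m)) (fib (1 + m)) (fib (2 + m)) (fib m)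

cyclicallyIndependent-count : ∀ m →
  length (filterᵇ cyclicallyIndependent (vectors bools (suc m))) ≡ lucas (suc m)
cyclicallyIndependent-count m = begin
  length (filterᵇ cyclicallyIndependent (vectors bools (suc m)))
    ≡⟨ length-filterᵇ-boolVectors m cyclicallyIndependent ⟩
  pathCount false false m + pathCount true true m
    ≡⟨ cong₂ _+_ (pathCount-ff m) (pathCount-tt m) ⟩
  fib (suc (suc m)) + fib m
    ≡⟨ lucas≡fib+fib m ⟨
  lucas (suc m) ∎
  where open ≡-Reasoning

noTrue : ∀ {m} → Vec Bool m → Bool
noTrue v = V.countᵇ id v <ᵇ 1

atMostOneTrue : ∀ {m} → Vec Bool m → Bool
atMostOneTrue v = V.countᵇ id v <ᵇ 2

noTrue-count : ∀ m → length (filterᵇ noTrue (vectors bools m)) ≡ 1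
noTrue-count zero    = refl
noTrue-count (suc m) = trans (length-filterᵇ-boolVectors m noTrue)
                             (cong₂ _+_ (noTrue-count m) (length-filterᵇ-false (vectors bools m)))

atMostOneTrue-count : ∀ m → length (filterᵇ atMostOneTrue (vectors bools m)) ≡ suc m
atMostOneTrue-count zero    = refl
atMostOneTrue-count (suc m) = trans (length-filterᵇ-boolVectors m atMostOneTrue)
                                    (trans (cong₂ _+_ (atMostOneTrue-count m) (noTrue-count m)) (+-comm (suc m) 1))

noTrue⇒noAdjacentTrues : ∀ {m} (w : Vec Bool m) e → T (noTrue w) → T (noAdjacentTrues false w e)
noTrue⇒noAdjacentTrues []          e _ = _
noTrue⇒noAdjacentTrues (false ∷ w) e h = noTrue⇒noAdjacentTrues w e h

atMostOneTrue⇒noAdjacentTrues : ∀ {m} (w : Vec Bool m) → T (atMostOneTrue w) → T (noAdjacentTrues false w false)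
atMostOneTrue⇒noAdjacentTrues []                 _ = _
atMostOneTrue⇒noAdjacentTrues (false ∷ w)        h = atMostOneTrue⇒noAdjacentTrues w h
atMostOneTrue⇒noAdjacentTrues (true ∷ [])        _ = _
atMostOneTrue⇒noAdjacentTrues (true ∷ false ∷ w) h = noTrue⇒noAdjacentTrues w false h

atMostOneTrue⇒cyclicallyIndependent : ∀ {m} (v : Vec Bool (2 + m)) →
  T (atMostOneTrue v) → T (cyclicallyIndependent v)
atMostOneTrue⇒cyclicallyIndependent (false ∷ w)        h = atMostOneTrue⇒noAdjacentTrues w h
atMostOneTrue⇒cyclicallyIndependent (true ∷ false ∷ w) h = noTrue⇒noAdjacentTrues w true h

independent≥2 : ∀ {m} → Vec Bool m → Bool
independent≥2 v = cyclicallyIndependent v ∧ not (atMostOneTrue v)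

independent≥2-count : ∀ m →
  length (filterᵇ independent≥2 (vectors bools (2 + m))) ≡ lucas (2 + m) ∸ (2 + m) ∸ 1
independent≥2-count m = sym (begin
  lucas n ∸ n ∸ 1       ≡⟨ cong (λ l → l ∸ n ∸ 1) lucas≡small+large ⟨
  suc n + large ∸ n ∸ 1 ≡⟨ cong (λ l → l ∸ n ∸ 1) (+-suc n large) ⟨
  n + suc large ∸ n ∸ 1 ≡⟨ cong (_∸ 1) (m+n∸m≡n n (suc large)) ⟩
  large                 ∎)
  where
  open ≡-Reasoning
  n : ℕ
  n = 2 + m
  vs : List (Vec Bool n)
  vs = vectors bools n
  large : ℕ
  large = length (filterᵇ independent≥2 vs)
  sparse-independent : ∀ v → cyclicallyIndependent v ∧ atMostOneTrue v ≡ atMostOneTrue v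
  sparse-independent v with atMostOneTrue v in eq
  ... | false = ∧-zeroʳ _
  ... | true  = trans (∧-identityʳ _) (to T-≡ (atMostOneTrue⇒cyclicallyIndependent v (subst T (sym eq) _)))
  lucas≡small+large : suc n + large ≡ lucas n
  lucas≡small+large = begin
    suc n + large
      ≡⟨ cong (_+ large) (trans (cong length (filterᵇ-≗ sparse-independent vs)) (atMostOneTrue-count n)) ⟨
    length (filterᵇ (λ v → cyclicallyIndependent v ∧ atMostOneTrue v) vs) + large
      ≡⟨ length-filterᵇ-split cyclicallyIndependent atMostOneTrue vs ⟩
    length (filterᵇ cyclicallyIndependent vs)
      ≡⟨ cyclicallyIndependent-count (suc m) ⟩
    lucas n ∎

-- The cyclic shift

lookup-∷ʳ-inject₁ : ∀ {A : Set} {m} (xs : Vec A m) y j → lookup (xs ∷ʳ y) (inject₁ j) ≡ lookup xs j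
lookup-∷ʳ-inject₁ (x ∷ xs) y zero    = refl
lookup-∷ʳ-inject₁ (x ∷ xs) y (suc j) = lookup-∷ʳ-inject₁ xs y j

lookup-∷ʳ-fromℕ : ∀ {A : Set} {m} (xs : Vec A m) y → lookup (xs ∷ʳ y) (fromℕ m) ≡ y
lookup-∷ʳ-fromℕ []       y = refl
lookup-∷ʳ-fromℕ (x ∷ xs) y = lookup-∷ʳ-fromℕ xs y

-- i ↦ i + 1 (mod n)
next : ∀ {n} → Fin n → Fin n
next {n} = lookup (CS n)

next-inject₁ : ∀ {m} (j : Fin m) → next (inject₁ j) ≡ suc j
next-inject₁ {m} j = begin
  lookup (V.map suc (V.allFin m) ∷ʳ zero) (inject₁ j) ≡⟨ lookup-∷ʳ-inject₁ (V.map suc (V.allFin m)) zero j ⟩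
  lookup (V.map suc (V.allFin m)) j                   ≡⟨ lookup-map j suc (V.allFin m) ⟩
  suc (lookup (V.allFin m) j)                         ≡⟨ cong suc (lookup-allFin j) ⟩
  suc j                                               ∎
  where open ≡-Reasoning

next-fromℕ : ∀ m → next (fromℕ m) ≡ zero
next-fromℕ m = lookup-∷ʳ-fromℕ (V.map suc (V.allFin m)) zero

CSlast-suc : ∀ {m} (j : Fin m) → lookup (CSlast (suc m)) (suc j) ≡ inject₁ j
CSlast-suc {m} j = trans (lookup-map j inject₁ (V.allFin m)) (cong inject₁ (lookup-allFin j))

next∘CSlast : ∀ {n} (i : Fin n) → next (lookup (CSlast n) i) ≡ i
next∘CSlast {suc m} zero    = next-fromℕ m
next∘CSlast {suc m} (suc j) = trans (cong next (CSlast-suc j)) (next-inject₁ j)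

CSlast∘next : ∀ {n} (i : Fin n) → lookup (CSlast n) (next i) ≡ i
CSlast∘next {suc m} i with view i
... | ‵fromℕ     = cong (lookup (CSlast (suc m))) (next-fromℕ m)
... | ‵inject₁ j = trans (cong (lookup (CSlast (suc m))) (next-inject₁ j)) (CSlast-suc j)

next-injective : ∀ {n} → Injective _≡_ _≡_ (next {n})
next-injective {x = x} {y} eq = trans (sym (CSlast∘next x)) (trans (cong (lookup (CSlast _)) eq) (CSlast∘next y))

CSlast-injective : ∀ {n} → Injective _≡_ _≡_ (lookup (CSlast n))
CSlast-injective {x = x} {y} eq = trans (sym (next∘CSlast x)) (trans (cong next eq) (next∘CSlast y))

next-fixedPointFree : ∀ {k} → 2 ≤ k → (i : Fin k) → next i ≢ i
next-fixedPointFree {suc zero}    (s≤s ()) _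
next-fixedPointFree {suc (suc m)} _        i with view i
... | ‵fromℕ     = λ eq → F.0≢1+n (trans (sym (next-fromℕ (suc m))) eq)
... | ‵inject₁ j = λ eq → 1+n≢n (trans (cong toℕ (trans (sym (next-inject₁ j)) eq)) (F.toℕ-inject₁ j))

next-Fin1 : ∀ {k} → k ≡ 1 → (j : Fin k) → next j ≡ j
next-Fin1 refl zero = refl

next-of-succ : ∀ {k} {p q : Fin k} → toℕ q ≡ suc (toℕ p) → q ≡ next p
next-of-succ {suc k} {p} {q} q≡1+p with view p
... | ‵inject₁ p′ =
  trans (F.toℕ-injective (trans q≡1+p (cong suc (F.toℕ-inject₁ p′)))) (sym (next-inject₁ p′))
... | ‵fromℕ      = contradiction (trans q≡1+p (cong suc (F.toℕ-fromℕ k))) (<⇒≢ (F.toℕ<n q))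

next-of-last : ∀ {k} {p q : Fin k} → toℕ q ≡ 0 → suc (toℕ p) ≡ k → q ≡ next p
next-of-last {suc k} {p} {q} q≡0 1+p≡k with view p
... | ‵fromℕ      = trans (F.toℕ-injective q≡0) (sym (next-fromℕ k))
... | ‵inject₁ p′ =
  contradiction (trans (sym (F.toℕ-inject₁ p′)) (suc-injective 1+p≡k)) (<⇒≢ (F.toℕ<n p′))

CSL-CS : ∀ {n k} → k ≢ n → CSL n k ≡ CS k
CSL-CS {n} {k} k≢n with k ≡ᵇ n in eq
... | true  = contradiction (≡ᵇ⇒≡ k n (subst T (sym eq) _)) k≢n
... | false = refl

CSL-CSlast : ∀ {n k} → k ≡ n → CSL n k ≡ CSlast k
CSL-CSlast {n} refl rewrite to T-≡ (≡⇒≡ᵇ n n refl) = refl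

Independent : ∀ {n} → (Fin n → Bool) → Set
Independent b = ∀ i → T (b i) → ¬ T (b (next i))

T-nand : ∀ {a b} → T (not (a ∧ b)) ⇔ (T a → ¬ T b)
T-nand {false}        = mk⇔ (λ _ ()) _
T-nand {true} {false} = mk⇔ (λ _ _ ()) _
T-nand {true} {true}  = mk⇔ (λ ()) (λ h → h _ _)

noAdjacentTrues⁺ : ∀ {m} p (w : Vec Bool m) e →
  (∀ j → T (lookup (p ∷ w) j) → ¬ T (lookup (w ∷ʳ e) j)) → T (noAdjacentTrues p w e)
noAdjacentTrues⁺ p []      e h = from T-nand (h zero)
noAdjacentTrues⁺ p (x ∷ w) e h = from T-∧ (from T-nand (h zero) , noAdjacentTrues⁺ x w e (h ∘ suc))

noAdjacentTrues⁻ : ∀ {m} p (w : Vec Bool m) e → T (noAdjacentTrues p w e) →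
  ∀ j → T (lookup (p ∷ w) j) → ¬ T (lookup (w ∷ʳ e) j)
noAdjacentTrues⁻ p []      e h zero    = to T-nand h
noAdjacentTrues⁻ p (x ∷ w) e h zero    = to T-nand (proj₁ (to T-∧ h))
noAdjacentTrues⁻ p (x ∷ w) e h (suc j) = noAdjacentTrues⁻ x w e (proj₂ (to T-∧ h)) j

lookup-next : ∀ {A : Set} {m} x (w : Vec A m) j → lookup (x ∷ w) (next j) ≡ lookup (w ∷ʳ x) j
lookup-next {m = m} x w j with view j
... | ‵fromℕ     = trans (cong (lookup (x ∷ w)) (next-fromℕ m)) (sym (lookup-∷ʳ-fromℕ w x))
... | ‵inject₁ i = trans (cong (lookup (x ∷ w)) (next-inject₁ i)) (sym (lookup-∷ʳ-inject₁ w x i))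

cyclicallyIndependent⇔Independent : ∀ {m} (v : Vec Bool (suc m)) →
  T (cyclicallyIndependent v) ⇔ Independent (lookup v)
cyclicallyIndependent⇔Independent (x ∷ w) = mk⇔
  (λ h i bi → subst (¬_ ∘ T) (sym (lookup-next x w i)) (noAdjacentTrues⁻ x w x h i bi))
  (λ h → noAdjacentTrues⁺ x w x (λ i bi → subst (¬_ ∘ T) (lookup-next x w i) (h i bi)))

-- Strictly increasing enumerations

module _ {k n} {w : Fin k → Fin n} (mono : w Preserves F._<_ ⟶ F._<_) where

  strictlyIncreasing-injective : Injective _≡_ _≡_ w
  strictlyIncreasing-injective {p} {q} wp≡wq with F.<-cmp p q
  ... | tri< p<q _ _ = contradiction wp≡wq (F.<⇒≢ (mono p<q))
  ... | tri≈ _ p≡q _ = p≡q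
  ... | tri> _ _ q<p = contradiction (sym wp≡wq) (F.<⇒≢ (mono q<p))

  strictlyIncreasing-reflects-< : ∀ {p q} → w p F.< w q → p F.< q
  strictlyIncreasing-reflects-< {p} {q} wp<wq with F.<-cmp p q
  ... | tri< p<q _ _  = p<q
  ... | tri≈ _ refl _ = contradiction wp<wq (<-irrefl refl)
  ... | tri> _ _ q<p  = contradiction (mono q<p) (<-asym wp<wq)

  strictlyIncreasing-succ : ∀ {p q} → toℕ (w q) ≡ suc (toℕ (w p)) → toℕ q ≡ suc (toℕ p)
  strictlyIncreasing-succ {p} {q} wq≡1+wp = ≤-antisym (≮⇒≥ noneBetween) p<q
    where
    p<q : p F.< q
    p<q = strictlyIncreasing-reflects-< (≤-reflexive (sym wq≡1+wp))
    noneBetween : ¬ suc (toℕ p) < toℕ q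
    noneBetween 1+p<q = <⇒≱ (mono p<r) (s≤s⁻¹ (subst (toℕ (w r) <_) wq≡1+wp (mono r<q)))
      where
      r : Fin k
      r = F.fromℕ< (<-trans 1+p<q (F.toℕ<n q))
      p<r : p F.< r
      p<r = subst (toℕ p <_) (sym (F.toℕ-fromℕ< _)) ≤-refl
      r<q : r F.< q
      r<q = subst (_< toℕ q) (sym (F.toℕ-fromℕ< _)) 1+p<q

  strictlyIncreasing-zero : ∀ {q} → toℕ (w q) ≡ 0 → toℕ q ≡ 0
  strictlyIncreasing-zero {zero}  _    = refl
  strictlyIncreasing-zero {suc q} wq≡0 = contradiction (subst (toℕ (w zero) <_) wq≡0 (mono z<s)) n≮0

  strictlyIncreasing-last : ∀ {p} → suc (toℕ (w p)) ≡ n → suc (toℕ p) ≡ k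
  strictlyIncreasing-last {p} 1+wp≡n = ≤-antisym (F.toℕ<n p) (≮⇒≥ notLast)
    where
    notLast : ¬ suc (toℕ p) < k
    notLast 1+p<k = <⇒≱ (mono p<r) (s≤s⁻¹ (subst (toℕ (w r) <_) (sym 1+wp≡n) (F.toℕ<n (w r))))
      where
      r : Fin k
      r = F.fromℕ< 1+p<k
      p<r : p F.< r
      p<r = subst (toℕ p <_) (sym (F.toℕ-fromℕ< _)) ≤-refl

  strictlyIncreasing-next : ∀ {p q} → w q ≡ next (w p) → q ≡ next p
  strictlyIncreasing-next {p} {q} wq≡next-wp with w p in wp≡x
  ... | x with view x
  ...   | ‵inject₁ x′ = next-of-succ (strictlyIncreasing-succ (begin
    toℕ (w q)              ≡⟨ cong toℕ (trans wq≡next-wp (next-inject₁ x′)) ⟩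
    suc (toℕ x′)           ≡⟨ cong suc (F.toℕ-inject₁ x′) ⟨
    suc (toℕ (inject₁ x′)) ≡⟨ cong (suc ∘ toℕ) wp≡x ⟨
    suc (toℕ (w p))        ∎))
    where open ≡-Reasoning
  ...   | ‵fromℕ {n = m} = next-of-last
    (strictlyIncreasing-zero (cong toℕ (trans wq≡next-wp (next-fromℕ m))))
    (strictlyIncreasing-last (cong suc (trans (cong toℕ wp≡x) (F.toℕ-fromℕ m))))

lookup-fromList : ∀ {A : Set} (xs : List A) i → lookup (V.fromList xs) i ≡ L.lookup xs i
lookup-fromList (x ∷ xs) zero    = refl
lookup-fromList (x ∷ xs) (suc i) = lookup-fromList xs i

AllPairs-lookup : ∀ {A : Set} {R : A → A → Set} {xs : List A} → AllPairs R xs →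
                  ∀ {i j} → i F.< j → R (L.lookup xs i) (L.lookup xs j)
AllPairs-lookup (r ∷ rs) {zero}  {suc j} _       = All.lookup r (∈-lookup j)
AllPairs-lookup (r ∷ rs) {suc i} {suc j} 1+i<1+j = AllPairs-lookup rs (s≤s⁻¹ 1+i<1+j)

positions : ∀ {n} → (Fin n → Bool) → List (Fin n)
positions {n} b = filterᵇ b (allFin n)

positions-cong : ∀ {n} {b b′ : Fin n → Bool} → (∀ i → b i ≡ b′ i) → positions b ≡ positions b′
positions-cong {n} b≗b′ = filterᵇ-≗ b≗b′ (allFin n)

enum : ∀ {n} (b : Fin n → Bool) → Fin (length (positions b)) → Fin n
enum b = lookup (V.fromList (positions b))

module _ {n} (b : Fin n → Bool) where

  enum-sound : ∀ j → T (b (enum b j))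
  enum-sound j = proj₂ (∈-filter⁻ (T? ∘ b) {xs = allFin n}
    (subst (_∈ positions b) (sym (lookup-fromList (positions b) j)) (∈-lookup {xs = positions b} j)))

  enum-complete : ∀ {i} → T (b i) → ∃ λ j → enum b j ≡ i
  enum-complete {i} bi = Any.index i∈ , trans (lookup-fromList (positions b) _) (sym (lookup-index i∈))
    where
    i∈ : i ∈ positions b
    i∈ = ∈-filter⁺ (T? ∘ b) (∈-allFin i) bi

  enum-strictlyIncreasing : enum b Preserves F._<_ ⟶ F._<_
  enum-strictlyIncreasing {p} {q} p<q =
    subst₂ F._<_ (sym (lookup-fromList (positions b) p)) (sym (lookup-fromList (positions b) q))
      (AllPairs-lookup (AllPairs.filter⁺ (T? ∘ b) (AllPairs.tabulate⁺-< {f = id} id)) p<q)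

  enum-injective : Injective _≡_ _≡_ (enum b)
  enum-injective = strictlyIncreasing-injective enum-strictlyIncreasing

  positions-length< : ∀ {i} → ¬ T (b i) → length (positions b) < n
  positions-length< {i} ¬bi = subst (length (positions b) <_) (length-tabulate id)
    (filter-notAll (T? ∘ b) (allFin n) (Any.map (λ { refl → ¬bi }) (∈-allFin i)))

length-positions-tail : ∀ {n} x (v : Vec Bool n) →
  length (filterᵇ (lookup (x ∷ v)) (L.tabulate suc)) ≡ length (positions (lookup v))
length-positions-tail {n} x v = trans (cong (length ∘ filterᵇ (lookup (x ∷ v))) (sym (map-tabulate id suc)))
                                      (length-filterᵇ-map (lookup (x ∷ v)) suc (allFin n))

countᵇ≡length-positions : ∀ {n} (v : Vec Bool n) → V.countᵇ id v ≡ length (positions (lookup v))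
countᵇ≡length-positions []          = refl
countᵇ≡length-positions (true ∷ v)  =
  cong suc (trans (countᵇ≡length-positions v) (sym (length-positions-tail true v)))
countᵇ≡length-positions (false ∷ v) =
  trans (countᵇ≡length-positions v) (sym (length-positions-tail false v))

T-not-<ᵇ2 : ∀ k → T (not (k <ᵇ 2)) ⇔ 2 ≤ k
T-not-<ᵇ2 zero          = mk⇔ (λ ()) (λ ())
T-not-<ᵇ2 (suc zero)    = mk⇔ (λ ()) (λ { (s≤s ()) })
T-not-<ᵇ2 (suc (suc k)) = mk⇔ (λ _ → s≤s (s≤s z≤n)) _

independent≥2⇔ : ∀ {m} (v : Vec Bool (suc m)) →
  T (independent≥2 v) ⇔ (Independent (lookup v) × 2 ≤ length (positions (lookup v)))
independent≥2⇔ v = mk⇔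
  (λ h → let independent , large = to T-∧ h
         in to (cyclicallyIndependent⇔Independent v) independent
          , subst (2 ≤_) (countᵇ≡length-positions v) (to (T-not-<ᵇ2 _) large))
  (λ (independent , two≤) → from T-∧
         ( from (cyclicallyIndependent⇔Independent v) independent
         , from (T-not-<ᵇ2 _) (subst (2 ≤_) (sym (countᵇ≡length-positions v)) two≤)))

module _ {n k} (key : Fin k → Fin n) (val : Fin k → Fin n) where

  assoc-hit : Injective _≡_ _≡_ key → ∀ {j} js d → j ∈ js →
              assoc (map (λ j → key j , val j) js) (key j) d ≡ val j
  assoc-hit key-inj {j} (j′ ∷ js) d j∈ with key j′ F.≟ key j | j∈
  ... | yes kj′≡kj | _          = cong val (key-inj kj′≡kj)
  ... | no kj′≢kj  | here refl  = contradiction refl kj′≢kj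
  ... | no _       | there j∈js = assoc-hit key-inj js d j∈js

  assoc-miss : ∀ {i} → (∀ j → key j ≢ i) → ∀ js d → assoc (map (λ j → key j , val j) js) i d ≡ d
  assoc-miss miss []       d = refl
  assoc-miss {i} miss (j ∷ js) d with key j F.≟ i
  ... | yes kj≡i = contradiction kj≡i (miss j)
  ... | no _     = assoc-miss miss js d

-- The value at position w j moves to position w (σ j).  With w = fromList I and σ = S (length I)
-- for I = Iset π γ, this is `step S π γ` unfolded.
relocate : ∀ {n k} → Vec (Fin k) k → Vec (Fin n) k → Guess n → Guess n
relocate {k = k} σ w γ i = assoc (map (λ j → lookup w (lookup σ j) , γ (lookup w j)) (allFin k)) i (γ i)

module _ {n k} (σ : Vec (Fin k) k) (w : Vec (Fin n) k) where

  relocate-moved : Injective _≡_ _≡_ (lookup w) → Injective _≡_ _≡_ (lookup σ) →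
                   ∀ γ j → relocate σ w γ (lookup w (lookup σ j)) ≡ γ (lookup w j)
  relocate-moved w-inj σ-inj γ j =
    assoc-hit (lookup w ∘ lookup σ) (γ ∘ lookup w) (σ-inj ∘ w-inj) (allFin k) _ (∈-allFin j)

  relocate-fixed : ∀ {i} → (∀ j → lookup w j ≢ i) → ∀ γ → relocate σ w γ i ≡ γ i
  relocate-fixed miss γ = assoc-miss (lookup w ∘ lookup σ) (γ ∘ lookup w) (miss ∘ lookup σ) (allFin k) _

  relocate-cong : ∀ {γ γ′} → (∀ i → γ i ≡ γ′ i) → ∀ i → relocate σ w γ i ≡ relocate σ w γ′ i
  relocate-cong γ≗γ′ i =
    cong₂ (λ moves d → assoc moves i d)
          (map-cong (λ j → cong (_ ,_) (γ≗γ′ (lookup w j))) (allFin k)) (γ≗γ′ i)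

-- CSlast is the inverse of next, so moving every value along it shifts the guess by next.
relocate-CSlast : ∀ {n k} → k ≡ n → (w : Vec (Fin n) k) → (∀ j → toℕ (lookup w j) ≡ toℕ j) →
                  ∀ γ i → relocate (CSlast k) w γ i ≡ γ (next i)
relocate-CSlast refl w w≗id γ i = begin
  relocate (CSlast _) w γ i
    ≡⟨ cong (relocate (CSlast _) w γ) (sym (trans (w-id _) (CSlast∘next i))) ⟩
  relocate (CSlast _) w γ (lookup w (lookup (CSlast _) (next i)))
    ≡⟨ relocate-moved (CSlast _) w w-inj CSlast-injective γ (next i) ⟩
  γ (lookup w (next i))
    ≡⟨ cong γ (w-id (next i)) ⟩
  γ (next i) ∎
  where
  open ≡-Reasoning
  w-id : ∀ j → lookup w j ≡ j
  w-id j = F.toℕ-injective (w≗id j)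
  w-inj : Injective _≡_ _≡_ (lookup w)
  w-inj {x} {y} wx≡wy = trans (sym (w-id x)) (trans wx≡wy (w-id y))

toℕ-lookup-allFin : ∀ n (j : Fin (length (allFin n))) → toℕ (lookup (V.fromList (allFin n)) j) ≡ toℕ j
toℕ-lookup-allFin n j = begin
  toℕ (lookup (V.fromList (allFin n)) j)
    ≡⟨ cong toℕ (lookup-fromList (allFin n) j) ⟩
  toℕ (L.lookup (allFin n) j)
    ≡⟨ cong (toℕ ∘ L.lookup (allFin n)) (F.cast-involutive (sym len) len j) ⟨
  toℕ (L.lookup (allFin n) (F.cast (sym len) (F.cast len j)))
    ≡⟨ cong toℕ (lookup-tabulate id (F.cast len j)) ⟩
  toℕ (F.cast len j)
    ≡⟨ F.toℕ-cast len j ⟩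
  toℕ j ∎
  where
  open ≡-Reasoning
  len : length (allFin n) ≡ n
  len = length-tabulate id

-- Games with ρ = 2 ending at the third guess

T-not : ∀ {b} → T (not b) ⇔ (¬ T b)
T-not {false} = mk⇔ (λ _ ()) _
T-not {true}  = mk⇔ (λ ()) (λ ¬t → ¬t _)

T-== : ∀ {n} {x y : Fin n} → T (x == y) ⇔ x ≡ y
T-== = mk⇔ toWitness fromWitness

module _ {n} (p : Fin n → Bool) where

  full⇔all : T (length (filterᵇ p (allFin n)) ≡ᵇ n) ⇔ (∀ i → T (p i))
  full⇔all = mk⇔
    (λ full i → proj₂ (∈-filter⁻ (T? ∘ p) {xs = allFin n} (subst (i ∈_)
       (sym (filter-complete (T? ∘ p) (trans (≡ᵇ⇒≡ _ n full) (sym (length-tabulate id))))) (∈-allFin i))))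
    (λ all → ≡⇒≡ᵇ _ n (trans (cong length (filter-all (T? ∘ p) (All.universal all (allFin n))))
                             (length-tabulate id)))

  null⇔none : T (L.null (filterᵇ p (allFin n))) ⇔ (∀ i → ¬ T (p i))
  null⇔none = mk⇔
    (λ null i pi → null-∌ null (∈-filter⁺ (T? ∘ p) (∈-allFin i) pi))
    (λ none → subst (T ∘ L.null) (sym (filter-none (T? ∘ p) (All.universal none (allFin n)))) _)
    where
    null-∌ : ∀ {xs : List (Fin n)} {x} → T (L.null xs) → ¬ x ∈ xs
    null-∌ {[]} _ ()

  notFull⇔some¬ : T (not (length (filterᵇ p (allFin n)) ≡ᵇ n)) ⇔ ∃ λ i → ¬ T (p i)
  notFull⇔some¬ = mk⇔
    (λ notFull → F.¬∀⟶∃¬ n (T ∘ p) (T? ∘ p) (to T-not notFull ∘ from full⇔all))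
    (λ (i , ¬pi) → from T-not (λ full → ¬pi (to full⇔all full i)))

  notNull⇔some : T (not (L.null (filterᵇ p (allFin n)))) ⇔ ∃ λ i → T (p i)
  notNull⇔some = mk⇔
    (λ notNull → let i , ¬¬pi = F.¬∀⟶∃¬ n (¬_ ∘ T ∘ p) (¬? ∘ T? ∘ p)
                                          (to T-not notNull ∘ from null⇔none)
                 in i , decidable-stable (T? (p i)) ¬¬pi)
    (λ (i , pi) → from T-not (λ null → to null⇔none null i pi))

agree : ∀ {n} → ℕ → Vec (Fin n) n → Fin n → Bool
agree {n} r π i = guess r (CSL n) π i == lookup π i

counted : ∀ {n} → Vec (Fin n) n → Bool
counted {n} π = endsAt3 (CSL n) π ∧ rhoIs2 (CSL n) π

record Counted {n} (π : Vec (Fin n) n) : Set where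
  field
    𝒥₁-empty    : ∀ i → i ≢ lookup π i
    𝒥₂-nonempty : ∃ λ i → guess 2 (CSL n) π i ≡ lookup π i
    𝒥₂-notFull  : ∃ λ i → guess 2 (CSL n) π i ≢ lookup π i
    𝒥₃-full     : ∀ i → guess 3 (CSL n) π i ≡ lookup π i

counted⇔Counted : ∀ {m} (π : Vec (Fin (suc m)) (suc m)) → T (counted π) ⇔ Counted π
counted⇔Counted {m} π = mk⇔ counted⇒Counted Counted⇒counted
  where
  full empty : ℕ → Bool
  full r  = Jfull r (CSL (suc m)) π
  empty r = L.null (J r (CSL (suc m)) π)

  counted⇒Counted : T ((not (full 1) ∧ not (full 2) ∧ full 3) ∧ empty 1 ∧ not (empty 2)) → Counted π
  counted⇒Counted h = record
    { 𝒥₁-empty    = λ i → to (null⇔none (agree 1 π)) empty₁ i ∘ from T-==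
    ; 𝒥₂-nonempty = map₂ (to T-==) (to (notNull⇔some (agree 2 π)) nonempty₂)
    ; 𝒥₂-notFull  = map₂ (_∘ from T-==) (to (notFull⇔some¬ (agree 2 π)) notFull₂)
    ; 𝒥₃-full     = λ i → to T-== (to (full⇔all (agree 3 π)) full₃ i)
    }
    where
    ends : T (not (full 1) ∧ not (full 2) ∧ full 3)
    ends = proj₁ (to T-∧ h)
    ρ≡2 : T (empty 1 ∧ not (empty 2))
    ρ≡2 = proj₂ (to (T-∧ {not (full 1) ∧ not (full 2) ∧ full 3}) h)
    notFull₂ : T (not (full 2))
    notFull₂ = proj₁ (to T-∧ (proj₂ (to (T-∧ {not (full 1)}) ends)))
    full₃ : T (full 3)
    full₃ = proj₂ (to (T-∧ {not (full 2)}) (proj₂ (to (T-∧ {not (full 1)}) ends)))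
    empty₁ : T (empty 1)
    empty₁ = proj₁ (to T-∧ ρ≡2)
    nonempty₂ : T (not (empty 2))
    nonempty₂ = proj₂ (to (T-∧ {empty 1}) ρ≡2)

  Counted⇒counted : Counted π → T ((not (full 1) ∧ not (full 2) ∧ full 3) ∧ empty 1 ∧ not (empty 2))
  Counted⇒counted c = from T-∧
    ( from T-∧ ( from (notFull⇔some¬ (agree 1 π)) (zero , 𝒥₁-empty zero ∘ to T-==)
               , from T-∧ ( from (notFull⇔some¬ (agree 2 π)) (map₂ (_∘ to T-==) 𝒥₂-notFull)
                          , from (full⇔all (agree 3 π)) (from T-== ∘ 𝒥₃-full)))
    , from T-∧ ( from (null⇔none (agree 1 π)) (λ i → 𝒥₁-empty i ∘ to T-==)
               , from (notNull⇔some (agree 2 π)) (map₂ (from T-==) 𝒥₂-nonempty)))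
    where open Counted c

Derangement : ∀ {n} → Vec (Fin n) n → Set
Derangement π = ∀ i → i ≢ lookup π i

-- This is 𝓘₂ when π is a derangement, the second guess then being next.
mismatch : ∀ {n} → Vec (Fin n) n → Fin n → Bool
mismatch π i = not (next i == lookup π i)

-- The third guess of a game whose second guess is next and is wrong exactly on {i : b i}.
γ₃ : ∀ {n} → (Fin n → Bool) → Guess n
γ₃ {n} b = relocate (CSL n (length (positions b))) (V.fromList (positions b)) next

module _ {n} (π : Vec (Fin n) n) (der : Derangement π) where

  guess₂≗next : ∀ i → guess 2 (CSL n) π i ≡ next i
  guess₂≗next i = begin
    relocate (CSL n (length (Iset π id))) (V.fromList (Iset π id)) id i
      ≡⟨ cong (λ I → relocate (CSL n (length I)) (V.fromList I) id i) allWrong ⟩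
    relocate (CSL n (length (allFin n))) (V.fromList (allFin n)) id i
      ≡⟨ cong (λ σ → relocate σ (V.fromList (allFin n)) id i) (CSL-CSlast (length-tabulate id)) ⟩
    relocate (CSlast (length (allFin n))) (V.fromList (allFin n)) id i
      ≡⟨ relocate-CSlast (length-tabulate id) (V.fromList (allFin n)) (toℕ-lookup-allFin n) id i ⟩
    next i ∎
    where
    open ≡-Reasoning
    allWrong : Iset π id ≡ allFin n
    allWrong = filter-all (T? ∘ _) (All.universal (λ i → fromWitnessFalse (der i)) (allFin n))

  guess₃≗γ₃ : ∀ i → guess 3 (CSL n) π i ≡ γ₃ (mismatch π) i
  guess₃≗γ₃ i = begin
    relocate (CSL n (length I₂)) (V.fromList I₂) (guess 2 (CSL n) π) i
      ≡⟨ relocate-cong (CSL n (length I₂)) (V.fromList I₂) guess₂≗next i ⟩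
    relocate (CSL n (length I₂)) (V.fromList I₂) next i
      ≡⟨ cong (λ I → relocate (CSL n (length I)) (V.fromList I) next i) I₂≡mismatches ⟩
    γ₃ (mismatch π) i ∎
    where
    open ≡-Reasoning
    I₂ : List (Fin n)
    I₂ = Iset π (guess 2 (CSL n) π)
    I₂≡mismatches : I₂ ≡ positions (mismatch π)
    I₂≡mismatches = positions-cong (λ j → cong (λ x → not (x == lookup π j)) (guess₂≗next j))

module _ {n} (b : Fin n → Bool) where

  γ₃-fixed : ∀ {i} → ¬ T (b i) → γ₃ b i ≡ next i
  γ₃-fixed ¬bi = relocate-fixed (CSL n (length (positions b))) (V.fromList (positions b))
    (λ j wj≡i → ¬bi (subst (T ∘ b) wj≡i (enum-sound b j))) next

  γ₃-moved : length (positions b) < n → ∀ j → γ₃ b (enum b (next j)) ≡ next (enum b j)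
  γ₃-moved k<n j = trans
    (cong (λ σ → relocate σ (V.fromList (positions b)) next (enum b (next j))) (CSL-CS (<⇒≢ k<n)))
    (relocate-moved (CS _) (V.fromList (positions b)) (enum-injective b) next-injective next j)

  γ₃-cong : ∀ {b′} → (∀ i → b i ≡ b′ i) → ∀ i → γ₃ b i ≡ γ₃ b′ i
  γ₃-cong b≗b′ i = cong (λ I → relocate (CSL n (length I)) (V.fromList I) next i) (positions-cong b≗b′)

≢1⇒2≤ : ∀ {k} → Fin k → k ≢ 1 → 2 ≤ k
≢1⇒2≤ {suc zero}    _ k≢1 = contradiction refl k≢1
≢1⇒2≤ {suc (suc k)} _ _   = s≤s (s≤s z≤n)

module _ {m} (π : Vec (Fin (2 + m)) (2 + m)) (counted-π : T (counted π)) where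

  open Counted (to (counted⇔Counted π) counted-π)

  private
    b : Fin (2 + m) → Bool
    b = mismatch π
    guess₂≗next′ : ∀ i → guess 2 (CSL (2 + m)) π i ≡ next i
    guess₂≗next′ = guess₂≗next π 𝒥₁-empty

  π≗γ₃ : ∀ i → lookup π i ≡ γ₃ b i
  π≗γ₃ i = trans (sym (𝒥₃-full i)) (guess₃≗γ₃ π 𝒥₁-empty i)

  mismatch-length< : length (positions b) < 2 + m
  mismatch-length< = let i , right = 𝒥₂-nonempty in
    positions-length< b {i} (λ bi → toWitnessFalse bi (trans (sym (guess₂≗next′ i)) right))

  π-moved : ∀ j → lookup π (enum b (next j)) ≡ next (enum b j)
  π-moved j = trans (π≗γ₃ _) (γ₃-moved b mismatch-length< j)

  -- Adjacent mistakes x, next x are consecutive in the enumeration, so π would fix next x.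
  mismatch-independent : Independent b
  mismatch-independent _ bx bnx with enum-complete b bx | enum-complete b bnx
  ... | p , refl | q , wq≡next-wp = 𝒥₁-empty (enum b q) (sym (begin
    lookup π (enum b q)
      ≡⟨ cong (lookup π ∘ enum b) (strictlyIncreasing-next (enum-strictlyIncreasing b) wq≡next-wp) ⟩
    lookup π (enum b (next p))
      ≡⟨ π-moved p ⟩
    next (enum b p)
      ≡⟨ wq≡next-wp ⟨
    enum b q ∎))
    where open ≡-Reasoning

  two≤mismatch-length : 2 ≤ length (positions b)
  two≤mismatch-length = ≢1⇒2≤ j length≢1
    where
    wrong : T (b (proj₁ 𝒥₂-notFull))
    wrong = fromWitnessFalse (λ eq → proj₂ 𝒥₂-notFull (trans (guess₂≗next′ _) eq))
    j : Fin (length (positions b))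
    j = proj₁ (enum-complete b wrong)
    length≢1 : length (positions b) ≢ 1
    length≢1 length≡1 = toWitnessFalse (enum-sound b j) (sym (begin
      lookup π (enum b j)        ≡⟨ cong (lookup π ∘ enum b) (next-Fin1 length≡1 j) ⟨
      lookup π (enum b (next j)) ≡⟨ π-moved j ⟩
      next (enum b j)            ∎))
      where open ≡-Reasoning

  mismatch-independent≥2 : T (independent≥2 (tabulate b))
  mismatch-independent≥2 = from (independent≥2⇔ (tabulate b))
    ( (λ i bi bni → mismatch-independent i (subst T (lookup∘tabulate b i) bi)
                                           (subst T (lookup∘tabulate b (next i)) bni))
    , subst (λ I → 2 ≤ length I) (sym (positions-cong (lookup∘tabulate b))) two≤mismatch-length )

  γ₃-mismatch : tabulate (γ₃ (lookup (tabulate b))) ≡ π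
  γ₃-mismatch = trans
    (tabulate-cong λ i → trans (γ₃-cong (lookup (tabulate b)) (lookup∘tabulate b) i) (sym (π≗γ₃ i)))
    (tabulate∘lookup π)

module _ {m} (v : Vec Bool (2 + m)) (large : T (independent≥2 v)) where

  private
    b : Fin (2 + m) → Bool
    b = lookup v
    k : ℕ
    k = length (positions b)
    independent : Independent b
    independent = proj₁ (to (independent≥2⇔ v) large)
    two≤k : 2 ≤ k
    two≤k = proj₂ (to (independent≥2⇔ v) large)
    π : Vec (Fin (2 + m)) (2 + m)
    π = tabulate (γ₃ b)
    lookup-π : ∀ i → lookup π i ≡ γ₃ b i
    lookup-π = lookup∘tabulate (γ₃ b)

  some¬b : ∃ λ i → ¬ T (b i)
  some¬b with T? (b zero)
  ... | yes b0 = next zero , independent zero b0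
  ... | no ¬b0 = zero , ¬b0

  γ₃-rotates : ∀ j → γ₃ b (enum b (next j)) ≡ next (enum b j)
  γ₃-rotates = γ₃-moved b (positions-length< b (proj₂ some¬b))

  rotated-preimage : ∀ {x} → T (b x) → ∃ λ j → enum b (next j) ≡ x
  rotated-preimage bx with enum-complete b bx
  ... | p , wp≡x = lookup (CSlast k) p , trans (cong (enum b) (next∘CSlast p)) wp≡x

  rotated≢fixed : ∀ {x y} → T (b x) → ¬ T (b y) → γ₃ b x ≢ γ₃ b y
  rotated≢fixed {y = y} bx ¬by eq with rotated-preimage bx
  ... | j , refl = ¬by (subst (T ∘ b) wj≡y (enum-sound b j))
    where
    wj≡y : enum b j ≡ y
    wj≡y = next-injective (trans (sym (γ₃-rotates j)) (trans eq (γ₃-fixed b ¬by)))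

  γ₃-injective : Injective _≡_ _≡_ (γ₃ b)
  γ₃-injective {x} {y} eq with T? (b x) | T? (b y)
  ... | no ¬bx | no ¬by = next-injective (trans (sym (γ₃-fixed b ¬bx)) (trans eq (γ₃-fixed b ¬by)))
  ... | yes bx | no ¬by = contradiction eq (rotated≢fixed bx ¬by)
  ... | no ¬bx | yes by = contradiction (sym eq) (rotated≢fixed by ¬bx)
  ... | yes bx | yes by with rotated-preimage bx | rotated-preimage by
  ...   | j , refl | j′ , refl = cong (enum b ∘ next)
    (enum-injective b (next-injective (trans (sym (γ₃-rotates j)) (trans eq (γ₃-rotates j′)))))

  γ₃-derangement : ∀ i → i ≢ γ₃ b i
  γ₃-derangement i with T? (b i)
  ... | no ¬bi = λ eq → next-fixedPointFree (s≤s (s≤s z≤n)) i (sym (trans eq (γ₃-fixed b ¬bi)))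
  ... | yes bi with rotated-preimage bi
  ...   | j , refl = λ eq →
    independent (enum b j) (enum-sound b j) (subst (T ∘ b) (trans eq (γ₃-rotates j)) bi)

  γ₃-wrong : ∀ {i} → T (b i) → next i ≢ γ₃ b i
  γ₃-wrong bi eq with rotated-preimage bi
  ... | j , refl = next-fixedPointFree two≤k j (enum-injective b (next-injective (trans eq (γ₃-rotates j))))

  mismatch-γ₃ : ∀ i → mismatch π i ≡ b i
  mismatch-γ₃ i rewrite lookup-π i with T? (b i)
  ... | yes bi = trans (to T-≡ (fromWitnessFalse (γ₃-wrong bi))) (sym (to T-≡ bi))
  ... | no ¬bi = trans (cong not (to T-≡ (fromWitness (sym (γ₃-fixed b ¬bi))))) (sym (to T-not-≡ (from T-not ¬bi)))

  γ₃-Counted : Counted π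
  γ₃-Counted = record
    { 𝒥₁-empty    = der
    ; 𝒥₂-nonempty = let i , ¬bi = some¬b in
                    i , trans (guess₂≗next π der i) (sym (trans (lookup-π i) (γ₃-fixed b ¬bi)))
    ; 𝒥₂-notFull  = i₁ , λ eq →
                    γ₃-wrong (enum-sound b j₁) (trans (sym (guess₂≗next π der i₁)) (trans eq (lookup-π i₁)))
    ; 𝒥₃-full     = λ i → trans (guess₃≗γ₃ π der i) (trans (γ₃-cong (mismatch π) mismatch-γ₃ i) (sym (lookup-π i)))
    }
    where
    der : Derangement π
    der i = subst (i ≢_) (sym (lookup-π i)) (γ₃-derangement i)
    j₁ : Fin k
    j₁ = F.fromℕ< (<-≤-trans z<s two≤k)
    i₁ : Fin (2 + m)
    i₁ = enum b j₁

  γ₃-counted : T (counted π)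
  γ₃-counted = from (counted⇔Counted π) γ₃-Counted

  γ₃-mismatch-vector : tabulate (mismatch π) ≡ v
  γ₃-mismatch-vector = trans (tabulate-cong mismatch-γ₃) (tabulate∘lookup v)

  γ₃-lookup-injective : Injective _≡_ _≡_ (lookup π)
  γ₃-lookup-injective {i} {j} eq = γ₃-injective (trans (sym (lookup-π i)) (trans eq (lookup-π j)))

-- The formula holds for every n ≥ 2.
theorem4p10 : (n : ℕ) → 4 ≤ n → countCSL n ≡ lucas n ∸ n ∸ 1
theorem4p10 (suc (suc m)) _ = trans
  (length-filterᵇ-bijection (tabulate ∘ mismatch) (tabulate ∘ γ₃ ∘ lookup)
     (perms-unique (2 + m)) (vectors-unique bools-unique (2 + m))
     (λ {π} _ counted-π →
        ∈-vectors ∈-bools (tabulate (mismatch π)) , mismatch-independent≥2 π counted-π , γ₃-mismatch π counted-π)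
     (λ {v} _ large →
        ∈-perms (γ₃-lookup-injective v large) , γ₃-counted v large , γ₃-mismatch-vector v large))
  (independent≥2-count m)
theorem4p10 (suc zero) (s≤s ())
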